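{- Let $(G,\tau)$ be a signed graph, let $\mathbf{w}$ be a $(u,v)$-walk, and let $\mathbf{w}_1$ and $\mathbf{w}_2$ be $(v,u)$-walks in $G$. Then $\mu(\mathbf{w}_1+\mathbf{w}_2^{ -1})=\mu(\mathbf{w}+\mathbf{w}_1)\,\mu(\mathbf{w}+\mathbf{w}_2)$.
   Context: Graphs are finite and simple; a sign $\tau$ of $G$ assigns $1$ or $-1$ to each pair $(e,v)$ with $v$ an endpoint of edge $e$. A walk $\mathbf{w}:v_1e_1v_2\cdots e_tv_{t+1}$ has $e_i=v_iv_{i+1}$; it is a $(v_1,v_{t+1})$-walk; closed if $v_{t+1}=v_1$. $\mathbf{w}+\mathbf{w}'$ is the concatenation of $\mathbf{w}$ followed by $\mathbf{w}'$, and $\mathbf{w}^{ -1}$ is $\mathbf{w}$ read in reverse order. An internal vertex term $v_i$ ($1<i<t+1$) is unbalanced if $\tau(e_{i-1},v_i)\tau(e_i,v_i)=1$; if $\mathbf{w}$ is closed of length at least two, $v_1$ is also unbalanced if $\tau(e_t,v_1)\tau(e_1,v_1)=1$. $\mu(\mathbf{w})=(-1)^k$ where $k$ is the number of unbalanced vertex terms. -}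

module Defs where

open import Data.Nat using (ℕ; zero; suc; _+_; _≤_; _≤ᵇ_)
open import Data.Integer using (ℤ; -1ℤ; _^_)
open import Data.Fin using (Fin; _≟_)
open import Data.Bool using (Bool; true; false; if_then_else_; _∧_)
open import Relation.Nullary using (¬_; does)

data Sign : Set where
  pos neg : Sign   -- pos = 1, neg = -1

_·_ : Sign → Sign → Sign
pos · s = s
neg · pos = neg
neg · neg = pos

isPos : Sign → Bool
isPos pos = true
isPos neg = false

-- An edge e = xy is determined by its
-- endpoints, so a pair (e , v) with v an endpoint of e = vy is encoded by the
-- ordered pair (v , y):  τ v y  stands for  τ(vy , v).  Values of τ on
-- non-adjacent pairs are irrelevant.
record SignedGraph : Set₁ where
  field
    n      : ℕ
    Adj    : Fin n → Fin n → Set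
    sym    : ∀ {x y} → Adj x y → Adj y x
    irrefl : ∀ {x} → ¬ Adj x x
    τ      : Fin n → Fin n → Sign

module _ (G : SignedGraph) where
  open SignedGraph G

  V : Set
  V = Fin n

  data Walk : V → V → Set where
    [_]    : (x : V) → Walk x x
    _∷⟨_⟩_ : (x : V) {y z : V} → Adj x y → Walk y z → Walk x z

  length : ∀ {x y} → Walk x y → ℕ
  length [ x ] = 0
  length (x ∷⟨ _ ⟩ w) = suc (length w)

  _+w_ : ∀ {x y z} → Walk x y → Walk y z → Walk x z
  [ x ] +w w' = w'
  (x ∷⟨ a ⟩ w) +w w' = x ∷⟨ a ⟩ (w +w w')

  rev : ∀ {x y} → Walk x y → Walk y x
  rev [ x ] = [ x ]
  rev (x ∷⟨ a ⟩ w) = rev w +w (_ ∷⟨ sym a ⟩ [ x ])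

  unbalanced : V → V → V → Bool
  unbalanced a b c = isPos (τ b a · τ b c)

  count : Bool → ℕ
  count true = 1
  count false = 0

  internalFrom : ∀ {y z} → V → Walk y z → ℕ
  internalFrom p [ y ] = 0
  internalFrom p (y ∷⟨ _ ⟩ (_∷⟨_⟩_ z {z'} a w)) =
    count (unbalanced p y z) + internalFrom y (z ∷⟨ a ⟩ w)
  internalFrom p (y ∷⟨ _ ⟩ [ z ]) = count (unbalanced p y z)

  internal : ∀ {x y} → Walk x y → ℕ
  internal [ x ] = 0
  internal (x ∷⟨ _ ⟩ w) = internalFrom x w

  -- second vertex v2 (or v1 for the trivial walk)
  second : ∀ {x y} → Walk x y → V
  second [ x ] = x
  second (x ∷⟨ _ ⟩ [ y ]) = y
  second (x ∷⟨ _ ⟩ (y ∷⟨ _ ⟩ _)) = y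

  -- penultimate vertex v_t (or v1 for the trivial walk)
  penult : ∀ {x y} → Walk x y → V
  penult [ x ] = x
  penult (x ∷⟨ _ ⟩ [ y ]) = x
  penult (x ∷⟨ _ ⟩ (y ∷⟨ a ⟩ w)) = penult (y ∷⟨ a ⟩ w)

  unbalancedCount : ∀ {x y} → Walk x y → ℕ
  unbalancedCount {x} {y} w =
    internal w +
    (if does (x ≟ y) ∧ (2 ≤ᵇ length w)
       then count (unbalanced (penult w) x (second w))
       else 0)

  μ : ∀ {x y} → Walk x y → ℤ
  μ w = -1ℤ ^ unbalancedCount w

-- An unbalanced vertex term v is one whose factor −τ(e_in,v)τ(e_out,v) is −1,
-- so μ of a closed walk is the product of these factors over its vertex terms.
-- Regrouping the τ's by edges turns this into the edge product
-- ε = ∏ₑ −τ(e,x)τ(e,y), which is multiplicative under concatenation and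
-- invariant under reversal.  Hence μ(w₁+w₂⁻¹) = ε(w₁)ε(w₂) = ε(w)²ε(w₁)ε(w₂)
-- = μ(w+w₁)μ(w+w₂).
module Submission where

open import Defs
open import Level using (0ℓ)
open import Algebra.Bundles using (CommutativeMonoid)
open import Data.Integer using (ℤ; 1ℤ; -1ℤ; _*_; _^_)
open import Data.Nat using (ℕ; zero; suc; _+_)
open import Data.Fin using (_≟_)
open import Data.Product using (_,_)
open import Relation.Nullary using (contradiction)
open import Relation.Nullary.Decidable using (dec-true)
open import Relation.Binary.PropositionalEquality
  using (_≡_; refl; sym; cong; cong₂; isEquivalence; module ≡-Reasoning)

·-assoc : ∀ a b c → (a · b) · c ≡ a · (b · c)
·-assoc pos b c = refl
·-assoc neg pos c = refl
·-assoc neg neg pos = refl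
·-assoc neg neg neg = refl

·-comm : ∀ a b → a · b ≡ b · a
·-comm pos pos = refl
·-comm pos neg = refl
·-comm neg pos = refl
·-comm neg neg = refl

·-identityʳ : ∀ a → a · pos ≡ a
·-identityʳ pos = refl
·-identityʳ neg = refl

·-cancelʳ : ∀ a b → (a · b) · b ≡ a
·-cancelʳ pos pos = refl
·-cancelʳ pos neg = refl
·-cancelʳ neg pos = refl
·-cancelʳ neg neg = refl

·-commutativeMonoid : CommutativeMonoid 0ℓ 0ℓ
·-commutativeMonoid = record
  { isCommutativeMonoid = record
    { isMonoid = record
      { isSemigroup = record
        { isMagma = record { isEquivalence = isEquivalence ; ∙-cong = cong₂ _·_ }
        ; assoc = ·-assoc
        }
      ; identity = (λ _ → refl) , ·-identityʳ
      }
    ; comm = ·-comm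
    }
  }

open import Algebra.Solver.CommutativeMonoid ·-commutativeMonoid using (solve; _⊜_; _⊕_; id)

b·c≡[a·b]·[a·c] : ∀ a b c → b · c ≡ (a · b) · (a · c)
b·c≡[a·b]·[a·c] a b c = begin
  b · c                   ≡⟨ sym (·-cancelʳ (b · c) a) ⟩
  ((b · c) · a) · a       ≡⟨ solve 3 (λ a b c → ((b ⊕ c) ⊕ a) ⊕ a ⊜ (a ⊕ b) ⊕ (a ⊕ c)) refl a b c ⟩
  (a · b) · (a · c)       ∎
  where open ≡-Reasoning

parity : ℕ → Sign
parity zero = pos
parity (suc k) = neg · parity k

parity-+ : ∀ m k → parity (m + k) ≡ parity m · parity k
parity-+ zero k = refl
parity-+ (suc m) k = begin
  neg · parity (m + k)          ≡⟨ cong (neg ·_) (parity-+ m k) ⟩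
  neg · (parity m · parity k)   ≡⟨ sym (·-assoc neg (parity m) (parity k)) ⟩
  (neg · parity m) · parity k   ∎
  where open ≡-Reasoning

toℤ : Sign → ℤ
toℤ pos = 1ℤ
toℤ neg = -1ℤ

toℤ-· : ∀ a b → toℤ (a · b) ≡ toℤ a * toℤ b
toℤ-· pos pos = refl
toℤ-· pos neg = refl
toℤ-· neg pos = refl
toℤ-· neg neg = refl

-1^≡toℤ∘parity : ∀ k → -1ℤ ^ k ≡ toℤ (parity k)
-1^≡toℤ∘parity zero = refl
-1^≡toℤ∘parity (suc k) = begin
  -1ℤ * -1ℤ ^ k               ≡⟨ cong (-1ℤ *_) (-1^≡toℤ∘parity k) ⟩
  -1ℤ * toℤ (parity k)        ≡⟨ sym (toℤ-· neg (parity k)) ⟩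
  toℤ (neg · parity k)        ∎
  where open ≡-Reasoning

module _ (G : SignedGraph) where
  open SignedGraph G hiding (sym)

  edgeSign : V G → V G → Sign
  edgeSign x y = neg · (τ x y · τ y x)

  walkSign : ∀ {x y} → Walk G x y → Sign
  walkSign [ x ] = pos
  walkSign (_∷⟨_⟩_ x {y} _ w) = edgeSign x y · walkSign w

  walkSign-+w : ∀ {x y z} (w : Walk G x y) (w′ : Walk G y z) →
                walkSign (_+w_ G w w′) ≡ walkSign w · walkSign w′
  walkSign-+w [ x ] w′ = refl
  walkSign-+w (_∷⟨_⟩_ x {y} _ w) w′ = begin
    edgeSign x y · walkSign (_+w_ G w w′)        ≡⟨ cong (edgeSign x y ·_) (walkSign-+w w w′) ⟩
    edgeSign x y · (walkSign w · walkSign w′)    ≡⟨ sym (·-assoc (edgeSign x y) _ _) ⟩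
    (edgeSign x y · walkSign w) · walkSign w′    ∎
    where open ≡-Reasoning

  edgeSign-comm : ∀ x y → edgeSign x y ≡ edgeSign y x
  edgeSign-comm x y = cong (neg ·_) (·-comm (τ x y) (τ y x))

  walkSign-rev : ∀ {x y} (w : Walk G x y) → walkSign (rev G w) ≡ walkSign w
  walkSign-rev [ x ] = refl
  walkSign-rev (_∷⟨_⟩_ x {y} a w) = begin
    walkSign (_+w_ G (rev G w) (y ∷⟨ SignedGraph.sym G a ⟩ [ x ]))
                                         ≡⟨ walkSign-+w (rev G w) (y ∷⟨ SignedGraph.sym G a ⟩ [ x ]) ⟩
    walkSign (rev G w) · (edgeSign y x · pos)
                                         ≡⟨ cong₂ _·_ (walkSign-rev w) (·-identityʳ (edgeSign y x)) ⟩
    walkSign w · edgeSign y x            ≡⟨ ·-comm (walkSign w) (edgeSign y x) ⟩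
    edgeSign y x · walkSign w            ≡⟨ cong (_· walkSign w) (edgeSign-comm y x) ⟩
    edgeSign x y · walkSign w            ∎
    where open ≡-Reasoning

  vertexSign : V G → V G → V G → Sign
  vertexSign p y z = neg · (τ y p · τ y z)

  parity-count-unbalanced : ∀ p y z → parity (count G (unbalanced G p y z)) ≡ vertexSign p y z
  parity-count-unbalanced p y z with τ y p · τ y z
  ... | pos = refl
  ... | neg = refl

  -- Telescoping invariant: the two end factors are the τ's not yet paired
  -- into an edge sign.
  parity-internalFrom : ∀ p {y y′ z} (b : Adj y y′) (w : Walk G y′ z) →
    parity (internalFrom G p (y ∷⟨ b ⟩ w)) ≡
    (τ y p · walkSign (y ∷⟨ b ⟩ w)) · τ z (penult G (y ∷⟨ b ⟩ w))
  parity-internalFrom p {y} {y′} b [ .y′ ] = begin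
    parity (count G (unbalanced G p y y′))       ≡⟨ parity-count-unbalanced p y y′ ⟩
    neg · (τ y p · τ y y′)                        ≡⟨ sym (·-cancelʳ _ (τ y′ y)) ⟩
    ((neg · (τ y p · τ y y′)) · τ y′ y) · τ y′ y  ≡⟨ solve 4 (λ n P A B →
                                                        ((n ⊕ (P ⊕ A)) ⊕ B) ⊕ B ⊜ (P ⊕ ((n ⊕ (A ⊕ B)) ⊕ id)) ⊕ B)
                                                      refl neg (τ y p) (τ y y′) (τ y′ y) ⟩
    (τ y p · (edgeSign y y′ · pos)) · τ y′ y     ∎
    where open ≡-Reasoning
  parity-internalFrom p {y} {y′} b w@(.y′ ∷⟨ c ⟩ w′) = begin
    parity (count G (unbalanced G p y y′) + internalFrom G y w)
      ≡⟨ parity-+ (count G (unbalanced G p y y′)) (internalFrom G y w) ⟩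
    parity (count G (unbalanced G p y y′)) · parity (internalFrom G y w)
      ≡⟨ cong₂ _·_ (parity-count-unbalanced p y y′) (parity-internalFrom y c w′) ⟩
    vertexSign p y y′ · ((τ y′ y · walkSign w) · τ _ (penult G w))
      ≡⟨ solve 6 (λ n P A B W Z → (n ⊕ (P ⊕ A)) ⊕ ((B ⊕ W) ⊕ Z) ⊜ (P ⊕ ((n ⊕ (A ⊕ B)) ⊕ W)) ⊕ Z)
           refl neg (τ y p) (τ y y′) (τ y′ y) (walkSign w) (τ _ (penult G w)) ⟩
    (τ y p · (edgeSign y y′ · walkSign w)) · τ _ (penult G w)
      ∎
    where open ≡-Reasoning

  parity-unbalancedCount-closed : ∀ {x} (w : Walk G x x) → parity (unbalancedCount G w) ≡ walkSign w
  parity-unbalancedCount-closed {x} [ .x ] rewrite dec-true (x ≟ x) refl = refl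
  parity-unbalancedCount-closed {x} (.x ∷⟨ a ⟩ [ .x ]) = contradiction a irrefl
  parity-unbalancedCount-closed {x} (_∷⟨_⟩_ .x {y} a w@(.y ∷⟨ b ⟩ w′))
    rewrite dec-true (x ≟ x) refl = begin
      parity (internalFrom G x w + count G (unbalanced G q x y))
        ≡⟨ parity-+ (internalFrom G x w) (count G (unbalanced G q x y)) ⟩
      parity (internalFrom G x w) · parity (count G (unbalanced G q x y))
        ≡⟨ cong₂ _·_ (parity-internalFrom x b w′) (parity-count-unbalanced q x y) ⟩
      ((τ y x · walkSign w) · τ x q) · (neg · (τ x q · τ x y))
        ≡⟨ solve 5 (λ n Y W Q X →
             ((Y ⊕ W) ⊕ Q) ⊕ (n ⊕ (Q ⊕ X)) ⊜ (((n ⊕ (X ⊕ Y)) ⊕ W) ⊕ Q) ⊕ Q)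
             refl neg (τ y x) (walkSign w) (τ x q) (τ x y) ⟩
      ((edgeSign x y · walkSign w) · τ x q) · τ x q
        ≡⟨ ·-cancelʳ _ (τ x q) ⟩
      edgeSign x y · walkSign w
        ∎
    where
    q : V G
    q = penult G w
    open ≡-Reasoning

  μ-closed : ∀ {x y} (w : Walk G x y) (w′ : Walk G y x) →
             μ G (_+w_ G w w′) ≡ toℤ (walkSign w · walkSign w′)
  μ-closed w w′ = begin
    -1ℤ ^ unbalancedCount G (_+w_ G w w′)          ≡⟨ -1^≡toℤ∘parity (unbalancedCount G (_+w_ G w w′)) ⟩
    toℤ (parity (unbalancedCount G (_+w_ G w w′))) ≡⟨ cong toℤ (parity-unbalancedCount-closed (_+w_ G w w′)) ⟩
    toℤ (walkSign (_+w_ G w w′))                   ≡⟨ cong toℤ (walkSign-+w w w′) ⟩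
    toℤ (walkSign w · walkSign w′)                 ∎
    where open ≡-Reasoning

lemma4p2 : (G : SignedGraph) {u v : V G}
    (w : Walk G u v) (w₁ w₂ : Walk G v u) →
    μ G (_+w_ G w₁ (rev G w₂)) ≡ μ G (_+w_ G w w₁) * μ G (_+w_ G w w₂)
lemma4p2 G w w₁ w₂ = begin
  μ G (_+w_ G w₁ (rev G w₂))            ≡⟨ μ-closed G w₁ (rev G w₂) ⟩
  toℤ (s₁ · walkSign G (rev G w₂))      ≡⟨ cong (λ t → toℤ (s₁ · t)) (walkSign-rev G w₂) ⟩
  toℤ (s₁ · s₂)                         ≡⟨ cong toℤ (b·c≡[a·b]·[a·c] s s₁ s₂) ⟩
  toℤ ((s · s₁) · (s · s₂))             ≡⟨ toℤ-· (s · s₁) (s · s₂) ⟩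
  toℤ (s · s₁) * toℤ (s · s₂)           ≡⟨ sym (cong₂ _*_ (μ-closed G w w₁) (μ-closed G w w₂)) ⟩
  μ G (_+w_ G w w₁) * μ G (_+w_ G w w₂) ∎
  where
  open ≡-Reasoning
  s s₁ s₂ : Sign
  s = walkSign G w
  s₁ = walkSign G w₁
  s₂ = walkSign G w₂
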